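{- Let $g>1$ and let $\mathcal M$ be the Accola–Maclachlan map of type $\{2g+2,4\}$ on the Accola–Maclachlan surface $X$ of genus $g$. Then the patterns of the mirrors of the reflections of $\mathcal M$ are $(\mathbf{01})^2$, $(\mathbf{02})^2$ and $(\mathbf{12})^2$ if $g$ is odd, and $(\mathbf{01})^2$, $(\mathbf{02})^2$ and $(\mathbf{12})^4$ if $g$ is even.
   Context: The Accola–Maclachlan surface of genus $g$ is the two-sheeted covering of the Riemann sphere branched over the vertices of a regular $(2g+2)$-gon; it is $\mathbb H/K$ with $K$ normal in the triangle group $\Gamma[2,4,2g+2]$, and it carries a regular map $\mathcal M$ of type $\{2g+2,4\}$ (faces $(2g+2)$-gons, vertices of valency $4$) whose orientation-preserving automorphism group has order $8(g+1)$ and presentation $\langle A,B,C\mid A^2=B^{2g+2}=C^4=ABC=(C^{ -1}B)^2=1\rangle$, and whose full automorphism group is $\langle P,Q,R\mid P^2=Q^2=R^2=(PQ)^2=(QR)^{2g+2}=(RP)^4=(PRQR)^2=1\rangle$. The geometric points of a map are its vertices ($\mathbf 0$), edge-centres ($\mathbf 1$) and face-centres ($\mathbf 2$). The pattern of a mirror (fixed curve of a reflection of the map) is the cyclic sequence of geometric points met along it, written $(\ell)^K$ meaning the minimal repeating word $\ell$ repeated $K$ times. -}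

module Defs where

open import Level using (Level; _⊔_)
open import Algebra.Bundles using (Group)
open import Data.Nat using (ℕ; zero; suc; _+_; _*_; _<_)
open import Data.Fin using (Fin)
open import Data.List using (List; []; _∷_; length; map; upTo; concat; replicate; foldr)
open import Data.Product using (_×_; _,_; proj₁; proj₂; Σ; ∃)
open import Data.Sum using (_⊎_)
open import Relation.Nullary using (¬_)
open import Relation.Binary.PropositionalEquality using (_≡_)

-- The three canonical generating reflections P, Q, R of the full automorphism group
-- (equivalently: the three side types of a flag triangle).
data Gen : Set where
  gP gQ gR : Gen

-- Geometric points of a map: vertices (𝟎), edge-centres (𝟏), face-centres (𝟐).
data Point : Set where
  𝟎 𝟏 𝟐 : Point

_^ʷ_ : List Point → ℕ → List Point
w ^ʷ K = concat (replicate K w)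

module _ {c ℓ : Level} (G : Group c ℓ) where
  open Group G

  pow : Carrier → ℕ → Carrier
  pow x zero    = ε
  pow x (suc n) = x ∙ pow x n

  gen : (P Q R : Carrier) → Gen → Carrier
  gen P Q R gP = P
  gen P Q R gQ = Q
  gen P Q R gR = R

  evalWord : (P Q R : Carrier) → List Gen → Carrier
  evalWord P Q R = foldr (λ X acc → gen P Q R X ∙ acc) ε

  record AMRelations (g : ℕ) (P Q R : Carrier) : Set ℓ where
    field
      P² : P ∙ P ≈ ε
      Q² : Q ∙ Q ≈ ε
      R² : R ∙ R ≈ ε
      PQ² : pow (P ∙ Q) 2 ≈ ε
      QR^n : pow (Q ∙ R) (2 * g + 2) ≈ ε
      RP⁴ : pow (R ∙ P) 4 ≈ ε
      PRQR² : pow (P ∙ (R ∙ (Q ∙ R))) 2 ≈ ε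

  Generates : (P Q R : Carrier) → Set (c ⊔ ℓ)
  Generates P Q R = ∀ x → ∃ λ (w : List Gen) → evalWord P Q R w ≈ x

  record HasOrder (N : ℕ) : Set (c ⊔ ℓ) where
    field
      enum : Fin N → Carrier
      enum-inj : ∀ i j → enum i ≈ enum j → i ≡ j
      enum-surj : ∀ x → ∃ λ i → enum i ≈ x

  -- The regular map determined by (G, P, Q, R): flags are the elements of G,
  -- automorphisms act by left multiplication, and the flag k is adjacent to
  -- k∙P, k∙Q, k∙R across its sides of type P, Q, R.

  ends : Gen → Point × Point
  ends gP = 𝟎 , 𝟏
  ends gQ = 𝟏 , 𝟐
  ends gR = 𝟎 , 𝟐

  -- Half-turn about the geometric point of type i of the flag k is left
  -- multiplication by k ∙ halfTurn i ∙ k⁻¹, which sends flag k to k ∙ halfTurn i.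
  -- Rotation orders: vertex RP (order 4), edge-centre PQ (order 2),
  -- face-centre QR (order 2g+2).
  halfTurn : (g : ℕ) (P Q R : Carrier) → Point → Carrier
  halfTurn g P Q R 𝟎 = pow (R ∙ P) 2
  halfTurn g P Q R 𝟏 = P ∙ Q
  halfTurn g P Q R 𝟐 = pow (Q ∙ R) (suc g)

  -- Walking along a mirror through side (k, X): starting at the first end of
  -- the side, the m-th geometric point crossed alternates between the two ends.
  pointAt : Gen → ℕ → Point
  pointAt X zero          = proj₁ (ends X)
  pointAt X (suc zero)    = proj₂ (ends X)
  pointAt X (suc (suc m)) = pointAt X m

  -- The representing flag of the m-th side of the mirror walk: crossing a
  -- geometric point, the mirror continues along the opposite side, i.e. the
  -- image of the current side under the half-turn about that point.
  walk : (g : ℕ) (P Q R : Carrier) → Carrier → Gen → ℕ → Carrier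
  walk g P Q R k X zero    = k
  walk g P Q R k X (suc m) = walk g P Q R k X m ∙ halfTurn g P Q R (pointAt X m)

  SameSide : (P Q R : Carrier) → Gen → Carrier → Carrier → Set ℓ
  SameSide P Q R X k k' = (k' ≈ k) ⊎ (k' ≈ k ∙ gen P Q R X)

  -- The automorphism t (left multiplication) is a reflection fixing the side
  -- of type X of flag k pointwise (it swaps the two flags along that side).
  FixesSide : (P Q R : Carrier) → Carrier → Carrier → Gen → Set ℓ
  FixesSide P Q R t k X = t ∙ k ≈ k ∙ gen P Q R X

  -- w is the pattern (cyclic sequence of geometric points, read from the first
  -- end of the side) of the mirror (closed fixed curve) through the side of type
  -- X of flag k: the walk first returns to the initial side after length w steps,
  -- and w lists the points crossed.
  MirrorPattern : (g : ℕ) (P Q R : Carrier) → Carrier → Gen → List Point → Set ℓ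
  MirrorPattern g P Q R k X w =
    (0 < length w)
    × (w ≡ map (pointAt X) (upTo (length w)))
    × SameSide P Q R X k (walk g P Q R k X (length w))
    × (∀ m → 0 < m → m < length w → ¬ SameSide P Q R X k (walk g P Q R k X m))

-- The flags of the map are the elements of G, and walking along the mirror
-- through a side of type X multiplies alternately on the right by the
-- half-turns about the two ends of that side.  Automorphisms act by left
-- multiplication, so the pattern does not depend on the starting flag and is
-- computed from the identity.
module Submission where

open import Defs
open import Level using (Level; 0ℓ)
open import Algebra.Bundles using (Group)
open import Data.Nat using (ℕ; zero; suc; _+_; _*_; _<_; s≤s; z≤n; NonZero)
open import Data.Nat.Divisibility using (_∣_; divides; ∣-refl; ∣m∣n⇒∣m+n)
open import Data.Nat.DivMod using (_%_; _/_; m≡m%n+[m/n]*n; m%n<n)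
import Data.Nat.Properties as ℕP
open import Data.Fin as Fin using (Fin; punchOut; toℕ; fromℕ<; combine; remQuot)
open import Data.Fin.Properties
  using (_≟_; punchOut-injective; injective⇒≤; toℕ-fromℕ<; fromℕ<-injective)
  using (remQuot-combine; combine-injective)
open import Data.List using (List; []; _∷_; length; map; upTo)
open import Data.Product using (_×_; _,_; proj₁; proj₂; ∃)
open import Data.Sum using (_⊎_; inj₁; inj₂)
open import Data.Empty using (⊥-elim)
open import Relation.Nullary using (¬_; yes; no)
open import Relation.Binary.PropositionalEquality as ≡ using (_≡_; _≢_)
open import Tactic.MonoidSolver using (solve)
open import Data.Nat.Tactic.RingSolver using (solve-∀)

-- Names for the elements of Fin 8, which index the dihedral subgroup ⟨P, R⟩.
pattern d0 = Fin.zero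
pattern d1 = Fin.suc d0
pattern d2 = Fin.suc d1
pattern d3 = Fin.suc d2
pattern d4 = Fin.suc d3
pattern d5 = Fin.suc d4
pattern d6 = Fin.suc d5
pattern d7 = Fin.suc d6

-- Arithmetic identities about n = 2g + 2, written suc (suc (g + g)) below.
2g+2≡n : ∀ g → 2 * g + 2 ≡ suc (suc (g + g))
2g+2≡n = solve-∀

16[g+1]≡8n : ∀ g → 16 * (g + 1) ≡ 8 * suc (suc (g + g))
16[g+1]≡8n = solve-∀

[g+1]+[g+1]≡n : ∀ g → suc g + suc g ≡ suc (suc (g + g))
[g+1]+[g+1]≡n = solve-∀

[g+1][2g+1]≡[g+1]+gn : ∀ g → suc g * suc (g + g) ≡ suc g + g * suc (suc (g + g))
[g+1][2g+1]≡[g+1]+gn = solve-∀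

even-or-odd : ∀ m → 2 ∣ m ⊎ 2 ∣ suc m
even-or-odd zero = inj₁ (divides 0 ≡.refl)
even-or-odd (suc m) with even-or-odd m
... | inj₁ 2∣m   = inj₂ (∣m∣n⇒∣m+n ∣-refl 2∣m)
... | inj₂ 2∣1+m = inj₁ 2∣1+m

module GroupFacts {c ℓ : Level} (G : Group c ℓ) where
  open Group G
  open import Algebra.Properties.Group G using (inverseʳ-unique)
  open import Relation.Binary.Reasoning.Setoid setoid

  pow-+ : ∀ x i j → pow G x (i + j) ≈ pow G x i ∙ pow G x j
  pow-+ x zero    j = sym (identityˡ _)
  pow-+ x (suc i) j = trans (∙-congˡ (pow-+ x i j)) (sym (assoc _ _ _))

  pow-* : ∀ x i j → pow G x (i * j) ≈ pow G (pow G x j) i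
  pow-* x zero    j = refl
  pow-* x (suc i) j = trans (pow-+ x j (i * j)) (∙-congˡ (pow-* x i j))

  intertwine : ∀ {x y y'} → x ∙ y ≈ y' ∙ x → ∀ i → x ∙ pow G y i ≈ pow G y' i ∙ x
  intertwine {x} {y} {y'} xy≈y'x zero = trans (identityʳ x) (sym (identityˡ x))
  intertwine {x} {y} {y'} xy≈y'x (suc i) = begin
    x ∙ (y ∙ pow G y i)    ≈⟨ assoc _ _ _ ⟨
    (x ∙ y) ∙ pow G y i    ≈⟨ ∙-congʳ xy≈y'x ⟩
    (y' ∙ x) ∙ pow G y i   ≈⟨ assoc _ _ _ ⟩
    y' ∙ (x ∙ pow G y i)   ≈⟨ ∙-congˡ (intertwine xy≈y'x i) ⟩
    y' ∙ (pow G y' i ∙ x)  ≈⟨ assoc _ _ _ ⟨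
    pow G y' (suc i) ∙ x   ∎

  pow-cong : ∀ {x y} → x ≈ y → ∀ i → pow G x i ≈ pow G y i
  pow-cong x≈y zero    = refl
  pow-cong x≈y (suc i) = ∙-cong x≈y (pow-cong x≈y i)

  pow-comm : ∀ x i → x ∙ pow G x i ≈ pow G x i ∙ x
  pow-comm x = intertwine refl

  pow-multiple : ∀ {x n} → pow G x n ≈ ε → ∀ q → pow G x (q * n) ≈ ε
  pow-multiple {x} {n} xⁿ≈ε q = trans (pow-* x q n) (trans (pow-cong xⁿ≈ε q) (pow-ε q))
    where
    pow-ε : ∀ q → pow G ε q ≈ ε
    pow-ε zero    = refl
    pow-ε (suc q) = trans (identityˡ _) (pow-ε q)

  pow-mod : ∀ {x n} .{{_ : NonZero n}} → pow G x n ≈ ε → ∀ i → pow G x i ≈ pow G x (i % n)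
  pow-mod {x} {n} xⁿ≈ε i = begin
    pow G x i                                 ≡⟨ ≡.cong (pow G x) (m≡m%n+[m/n]*n i n) ⟩
    pow G x (i % n + (i / n) * n)             ≈⟨ pow-+ x (i % n) _ ⟩
    pow G x (i % n) ∙ pow G x ((i / n) * n)   ≈⟨ ∙-congˡ (pow-multiple xⁿ≈ε (i / n)) ⟩
    pow G x (i % n) ∙ ε                       ≈⟨ identityʳ _ ⟩
    pow G x (i % n)                           ∎

  commute-∙ : ∀ {x y y'} → x ∙ y ≈ y ∙ x → x ∙ y' ≈ y' ∙ x → x ∙ (y ∙ y') ≈ (y ∙ y') ∙ x
  commute-∙ {x} {y} {y'} xy≈yx xy'≈y'x = begin
    x ∙ (y ∙ y')   ≈⟨ assoc _ _ _ ⟨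
    (x ∙ y) ∙ y'   ≈⟨ ∙-congʳ xy≈yx ⟩
    (y ∙ x) ∙ y'   ≈⟨ assoc _ _ _ ⟩
    y ∙ (x ∙ y')   ≈⟨ ∙-congˡ xy'≈y'x ⟩
    y ∙ (y' ∙ x)   ≈⟨ assoc _ _ _ ⟨
    (y ∙ y') ∙ x   ∎

  cancelˡ : ∀ {y} → y ∙ y ≈ ε → ∀ x → y ∙ (y ∙ x) ≈ x
  cancelˡ yy x = trans (sym (assoc _ _ _)) (trans (∙-congʳ yy) (identityˡ x))

  cancelʳ : ∀ {y} → y ∙ y ≈ ε → ∀ x → (x ∙ y) ∙ y ≈ x
  cancelʳ yy x = trans (assoc _ _ _) (trans (∙-congˡ yy) (identityʳ x))

  cancel-middle : ∀ {y} → y ∙ y ≈ ε → ∀ x w → (x ∙ y) ∙ (y ∙ w) ≈ x ∙ w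
  cancel-middle yy x w = trans (assoc _ _ _) (∙-congˡ (cancelˡ yy w))

  inverse-unique : ∀ {x y y'} → x ∙ y ≈ ε → x ∙ y' ≈ ε → y ≈ y'
  inverse-unique {x} {y} {y'} xy xy' = trans (inverseʳ-unique x y xy) (sym (inverseʳ-unique x y' xy'))

  involutions-commute : ∀ {x y} → x ∙ x ≈ ε → y ∙ y ≈ ε → (x ∙ y) ∙ (x ∙ y) ≈ ε → x ∙ y ≈ y ∙ x
  involutions-commute {x} {y} xx yy xyxy = inverse-unique xyxy (begin
    (x ∙ y) ∙ (y ∙ x) ≈⟨ cancel-middle yy x x ⟩
    x ∙ x             ≈⟨ xx ⟩
    ε                 ∎)

  surjection-injective : ∀ {N} → HasOrder G N → (F : Fin N → Carrier) → (∀ x → ∃ λ a → F a ≈ x)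
                       → ∀ a b → F a ≈ F b → a ≡ b
  surjection-injective {suc M} order F onto a b Fa≈Fb with a ≟ b
  ... | yes a≡b = a≡b
  ... | no  a≢b = ⊥-elim (ℕP.n≮n M (injective⇒≤ squeeze-injective))
    where
    open HasOrder order
    -- a preimage under F of x that differs from b (use a instead of b)
    preimage : ∀ x → ∃ λ c → b ≢ c × F c ≈ x
    preimage x with proj₁ (onto x) ≟ b
    ... | yes c≡b = a , (λ b≡a → a≢b (≡.sym b≡a))
                      , trans Fa≈Fb (trans (reflexive (≡.cong F (≡.sym c≡b))) (proj₂ (onto x)))
    ... | no  c≢b = proj₁ (onto x) , (λ b≡c → c≢b (≡.sym b≡c)) , proj₂ (onto x)
    -- enumerate G, then pick preimages avoiding b: an injection Fin (suc M) → Fin M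
    avoids-b : ∀ i → b ≢ proj₁ (preimage (enum i))
    avoids-b i = proj₁ (proj₂ (preimage (enum i)))
    squeeze : Fin (suc M) → Fin M
    squeeze i = punchOut (avoids-b i)
    squeeze-injective : ∀ {i j} → squeeze i ≡ squeeze j → i ≡ j
    squeeze-injective {i} {j} eq = enum-inj i j (begin
      enum i                              ≈⟨ proj₂ (proj₂ (preimage (enum i))) ⟨
      F (proj₁ (preimage (enum i)))       ≡⟨ ≡.cong F (punchOut-injective (avoids-b i) (avoids-b j) eq) ⟩
      F (proj₁ (preimage (enum j)))       ≈⟨ proj₂ (proj₂ (preimage (enum j))) ⟩
      enum j                              ∎)

-- Since
-- automorphisms act by left multiplication, the walk from a flag k is k times
-- the walk from the identity flag; so a pattern is read off from the latter.
module MirrorWalks {c ℓ : Level} (G : Group c ℓ) (g : ℕ) (P Q R : Group.Carrier G) where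
  open Group G
  open import Algebra.Properties.Group G using (∙-cancelˡ)
  open import Relation.Binary.Reasoning.Setoid setoid

  LeavesSide : Gen → Carrier → Set ℓ
  LeavesSide X x = ¬ (x ≈ ε) × ¬ (x ≈ gen G P Q R X)

  leaves-resp : ∀ {X x y} → x ≈ y → LeavesSide X y → LeavesSide X x
  leaves-resp x≈y (y≉ε , y≉X) = (λ x≈ε → y≉ε (trans (sym x≈y) x≈ε))
                              , (λ x≈X → y≉X (trans (sym x≈y) x≈X))

  walk-from : ∀ k X m → walk G g P Q R k X m ≈ k ∙ walk G g P Q R ε X m
  walk-from k X zero    = sym (identityʳ k)
  walk-from k X (suc m) = trans (∙-congʳ (walk-from k X m)) (assoc _ _ _)

  mirror-pattern : ∀ X (w : List Point) → 0 < length w → w ≡ map (pointAt G X) (upTo (length w))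
    → walk G g P Q R ε X (length w) ≈ ε
    → (∀ m → 0 < m → m < length w → LeavesSide X (walk G g P Q R ε X m))
    → ∀ k → MirrorPattern G g P Q R k X w
  mirror-pattern X w 0<len w≡points returns leaves k =
    0<len , w≡points , inj₁ closes , λ m 0<m m<len → stays-off m (leaves m 0<m m<len)
    where
    closes : walk G g P Q R k X (length w) ≈ k
    closes = trans (walk-from k X (length w)) (trans (∙-congˡ returns) (identityʳ k))
    stays-off : ∀ m → LeavesSide X (walk G g P Q R ε X m) → ¬ SameSide G P Q R X k (walk G g P Q R k X m)
    stays-off m (≉ε , ≉X) (inj₁ at-k) =
      ≉ε (∙-cancelˡ k _ _ (trans (sym (walk-from k X m)) (trans at-k (sym (identityʳ k)))))
    stays-off m (≉ε , ≉X) (inj₂ at-kX) =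
      ≉X (∙-cancelˡ k _ _ (trans (sym (walk-from k X m)) at-kX))

  turn₁ turn₂ : Gen → Carrier
  turn₁ X = halfTurn G g P Q R (proj₁ (ends G X))
  turn₂ X = halfTurn G g P Q R (proj₂ (ends G X))

  endWord : Gen → List Point
  endWord X = proj₁ (ends G X) ∷ proj₂ (ends G X) ∷ []

  module _ (X : Gen) where
    open GroupFacts G
    private
      a b : Carrier
      a = turn₁ X
      b = turn₂ X
      W : ℕ → Carrier
      W = walk G g P Q R ε X

      step : ∀ m {x y} → W m ≈ x → x ∙ halfTurn G g P Q R (pointAt G X m) ≈ y → W (suc m) ≈ y
      step m Wm≈x x∙turn≈y = trans (∙-congʳ Wm≈x) x∙turn≈y

    mirror-of-commuting-turns : a ∙ a ≈ ε → b ∙ b ≈ ε → a ∙ b ≈ b ∙ a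
      → LeavesSide X a → LeavesSide X (a ∙ b) → LeavesSide X b
      → ∀ k → MirrorPattern G g P Q R k X (endWord X ^ʷ 2)
    mirror-of-commuting-turns aa bb ab≈ba leaves-a leaves-ab leaves-b =
      mirror-pattern X (endWord X ^ʷ 2) (s≤s z≤n) ≡.refl W4 leaves
      where
      W1 : W 1 ≈ a
      W1 = identityˡ a
      W2 : W 2 ≈ a ∙ b
      W2 = step 1 W1 refl
      W3 : W 3 ≈ b
      W3 = step 2 W2 (trans (∙-congʳ ab≈ba) (cancelʳ aa b))
      W4 : W 4 ≈ ε
      W4 = step 3 W3 bb
      leaves : ∀ m → 0 < m → m < 4 → LeavesSide X (W m)
      leaves 1 _ _ = leaves-resp W1 leaves-a
      leaves 2 _ _ = leaves-resp W2 leaves-ab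
      leaves 3 _ _ = leaves-resp W3 leaves-b
      leaves (suc (suc (suc (suc _)))) _ (s≤s (s≤s (s≤s (s≤s ()))))

    mirror-of-order-four-translation : ∀ {c} → a ∙ a ≈ ε → b ∙ b ≈ ε → (a ∙ b) ∙ (a ∙ b) ≈ c → c ∙ c ≈ ε
      → LeavesSide X a → LeavesSide X (a ∙ b) → LeavesSide X (c ∙ b) → LeavesSide X c
      → LeavesSide X (c ∙ a) → LeavesSide X (c ∙ (a ∙ b)) → LeavesSide X b
      → ∀ k → MirrorPattern G g P Q R k X (endWord X ^ʷ 4)
    mirror-of-order-four-translation {c} aa bb abab≈c cc l₁ l₂ l₃ l₄ l₅ l₆ l₇ =
      mirror-pattern X (endWord X ^ʷ 4) (s≤s z≤n) ≡.refl W8 leaves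
      where
      aba≈cb : (a ∙ b) ∙ a ≈ c ∙ b
      aba≈cb = begin
        (a ∙ b) ∙ a               ≈⟨ cancelʳ bb _ ⟨
        (((a ∙ b) ∙ a) ∙ b) ∙ b   ≈⟨ ∙-congʳ (trans (assoc _ _ _) abab≈c) ⟩
        c ∙ b                     ∎
      W1 : W 1 ≈ a
      W1 = identityˡ a
      W2 : W 2 ≈ a ∙ b
      W2 = step 1 W1 refl
      W3 : W 3 ≈ c ∙ b
      W3 = step 2 W2 aba≈cb
      W4 : W 4 ≈ c
      W4 = step 3 W3 (cancelʳ bb c)
      W5 : W 5 ≈ c ∙ a
      W5 = step 4 W4 refl
      W6 : W 6 ≈ c ∙ (a ∙ b)
      W6 = step 5 W5 (assoc _ _ _)
      W7 : W 7 ≈ b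
      W7 = step 6 W6 (begin
        (c ∙ (a ∙ b)) ∙ a  ≈⟨ assoc _ _ _ ⟩
        c ∙ ((a ∙ b) ∙ a)  ≈⟨ ∙-congˡ aba≈cb ⟩
        c ∙ (c ∙ b)        ≈⟨ cancelˡ cc b ⟩
        b                  ∎)
      W8 : W 8 ≈ ε
      W8 = step 7 W7 bb
      leaves : ∀ m → 0 < m → m < 8 → LeavesSide X (W m)
      leaves 1 _ _ = leaves-resp W1 l₁
      leaves 2 _ _ = leaves-resp W2 l₂
      leaves 3 _ _ = leaves-resp W3 l₃
      leaves 4 _ _ = leaves-resp W4 l₄
      leaves 5 _ _ = leaves-resp W5 l₅
      leaves 6 _ _ = leaves-resp W6 l₆
      leaves 7 _ _ = leaves-resp W7 l₇
      leaves (suc (suc (suc (suc (suc (suc (suc (suc _)))))))) _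
             (s≤s (s≤s (s≤s (s≤s (s≤s (s≤s (s≤s (s≤s ()))))))))

module AccolaMaclachlan {c ℓ : Level} (G : Group c ℓ) (g : ℕ) (P Q R : Group.Carrier G)
                        (rel : AMRelations G g P Q R) where
  open Group G
  open AMRelations rel
  open GroupFacts G
  open import Algebra.Properties.Group G using (∙-cancelʳ)
  open import Relation.Binary.Reasoning.Setoid setoid

  -- r is the rotation about a face-centre; z, e, f are the half-turns about a
  -- vertex, an edge-centre and a face-centre; P′ is P conjugated by R.
  r z e f P′ : Carrier
  r  = Q ∙ R
  z  = pow G (R ∙ P) 2
  e  = P ∙ Q
  f  = pow G r (suc g)
  P′ = R ∙ (P ∙ R)

  n : ℕ
  n = suc (suc (g + g))

  rⁿ : pow G r n ≈ ε
  rⁿ = ≡.subst (λ m → pow G r m ≈ ε) (2g+2≡n g) QR^n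

  e² : e ∙ e ≈ ε
  e² = trans (∙-congˡ (sym (identityʳ _))) PQ²

  PQ-comm : P ∙ Q ≈ Q ∙ P
  PQ-comm = involutions-commute P² Q² e²

  z≈RPRP : z ≈ R ∙ (P ∙ (R ∙ P))
  z≈RPRP = solve monoid

  z² : z ∙ z ≈ ε
  z² = trans (z∙z≈[RP]⁴) RP⁴
    where
    z∙z≈[RP]⁴ : (R ∙ P) ∙ ((R ∙ P) ∙ ε) ∙ ((R ∙ P) ∙ ((R ∙ P) ∙ ε))
              ≈ (R ∙ P) ∙ ((R ∙ P) ∙ ((R ∙ P) ∙ ((R ∙ P) ∙ ε)))
    z∙z≈[RP]⁴ = solve monoid

  RPRP≈PRPR : R ∙ (P ∙ (R ∙ P)) ≈ P ∙ (R ∙ (P ∙ R))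
  RPRP≈PRPR = inverse-unique (trans (∙-cong (sym z≈RPRP) (sym z≈RPRP)) z²) (begin
    R ∙ (P ∙ (R ∙ P)) ∙ (P ∙ (R ∙ (P ∙ R))) ≈⟨ solve monoid ⟩
    ((R ∙ P) ∙ R ∙ P) ∙ (P ∙ (R ∙ (P ∙ R))) ≈⟨ cancel-middle P² _ _ ⟩
    ((R ∙ P) ∙ R) ∙ (R ∙ (P ∙ R))           ≈⟨ cancel-middle R² _ _ ⟩
    (R ∙ P) ∙ (P ∙ R)                       ≈⟨ cancel-middle P² _ _ ⟩
    R ∙ R                                   ≈⟨ R² ⟩
    ε                                       ∎)

  -- The relation (PRQR)² = 1 says PRQR equals its reverse RQRP.
  PRQR≈RQRP : P ∙ (R ∙ (Q ∙ R)) ≈ R ∙ (Q ∙ (R ∙ P))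
  PRQR≈RQRP = inverse-unique (trans (∙-congˡ (sym (identityʳ _))) PRQR²) (begin
    P ∙ (R ∙ (Q ∙ R)) ∙ (R ∙ (Q ∙ (R ∙ P))) ≈⟨ solve monoid ⟩
    ((P ∙ R) ∙ Q ∙ R) ∙ (R ∙ (Q ∙ (R ∙ P))) ≈⟨ cancel-middle R² _ _ ⟩
    ((P ∙ R) ∙ Q) ∙ (Q ∙ (R ∙ P))           ≈⟨ cancel-middle Q² _ _ ⟩
    (P ∙ R) ∙ (R ∙ P)                       ≈⟨ cancel-middle R² _ _ ⟩
    P ∙ P                                   ≈⟨ P² ⟩
    ε                                       ∎)

  z-P : z ∙ P ≈ P ∙ z
  z-P = begin
    z ∙ P                         ≈⟨ solve monoid ⟩
    ((R ∙ P) ∙ R ∙ P) ∙ P         ≈⟨ cancelʳ P² _ ⟩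
    (R ∙ P) ∙ R                   ≈⟨ assoc _ _ _ ⟩
    R ∙ (P ∙ R)                   ≈⟨ cancelˡ P² _ ⟨
    P ∙ (P ∙ (R ∙ (P ∙ R)))       ≈⟨ ∙-congˡ (trans z≈RPRP RPRP≈PRPR) ⟨
    P ∙ z                         ∎

  z-R : z ∙ R ≈ R ∙ z
  z-R = begin
    z ∙ R                         ≈⟨ ∙-congʳ (trans z≈RPRP RPRP≈PRPR) ⟩
    P ∙ (R ∙ (P ∙ R)) ∙ R         ≈⟨ solve monoid ⟩
    ((P ∙ R) ∙ P ∙ R) ∙ R         ≈⟨ cancelʳ R² _ ⟩
    (P ∙ R) ∙ P                   ≈⟨ assoc _ _ _ ⟩
    P ∙ (R ∙ P)                   ≈⟨ cancelˡ R² _ ⟨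
    R ∙ (R ∙ (P ∙ (R ∙ P)))       ≈⟨ ∙-congˡ z≈RPRP ⟨
    R ∙ z                         ∎

  z-Q : z ∙ Q ≈ Q ∙ z
  z-Q = begin
    z ∙ Q                               ≈⟨ solve monoid ⟩
    (R ∙ P ∙ R) ∙ (P ∙ Q)               ≈⟨ ∙-congˡ PQ-comm ⟩
    (R ∙ P ∙ R) ∙ (Q ∙ P)               ≈⟨ solve monoid ⟩
    (R ∙ P ∙ R ∙ Q) ∙ P                 ≈⟨ cancel-middle R² _ _ ⟨
    ((R ∙ P ∙ R ∙ Q) ∙ R) ∙ (R ∙ P)     ≈⟨ solve monoid ⟩
    R ∙ (P ∙ (R ∙ (Q ∙ R))) ∙ (R ∙ P)   ≈⟨ ∙-congʳ (∙-congˡ PRQR≈RQRP) ⟩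
    R ∙ (R ∙ (Q ∙ (R ∙ P))) ∙ (R ∙ P)   ≈⟨ ∙-congʳ (cancelˡ R² _) ⟩
    Q ∙ (R ∙ P) ∙ (R ∙ P)               ≈⟨ solve monoid ⟩
    Q ∙ z                               ∎

  z-r : z ∙ r ≈ r ∙ z
  z-r = commute-∙ z-Q z-R

  z-e : z ∙ e ≈ e ∙ z
  z-e = commute-∙ z-P z-Q

  P-r : P ∙ r ≈ r ∙ P′
  P-r = begin
    P ∙ (Q ∙ R)               ≈⟨ assoc _ _ _ ⟨
    (P ∙ Q) ∙ R               ≈⟨ ∙-congʳ PQ-comm ⟩
    (Q ∙ P) ∙ R               ≈⟨ assoc _ _ _ ⟩
    Q ∙ (P ∙ R)               ≈⟨ cancel-middle R² _ _ ⟨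
    (Q ∙ R) ∙ (R ∙ (P ∙ R))   ∎

  P′-r : P′ ∙ r ≈ r ∙ P
  P′-r = begin
    R ∙ (P ∙ R) ∙ (Q ∙ R)     ≈⟨ solve monoid ⟩
    R ∙ (P ∙ (R ∙ (Q ∙ R)))   ≈⟨ ∙-congˡ PRQR≈RQRP ⟩
    R ∙ (R ∙ (Q ∙ (R ∙ P)))   ≈⟨ cancelˡ R² _ ⟩
    Q ∙ (R ∙ P)               ≈⟨ assoc _ _ _ ⟨
    (Q ∙ R) ∙ P               ∎

  P-r² : P ∙ pow G r 2 ≈ pow G r 2 ∙ P
  P-r² = begin
    P ∙ (r ∙ (r ∙ ε))   ≈⟨ solve monoid ⟩
    (P ∙ r) ∙ r         ≈⟨ ∙-congʳ P-r ⟩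
    (r ∙ P′) ∙ r        ≈⟨ assoc _ _ _ ⟩
    r ∙ (P′ ∙ r)        ≈⟨ ∙-congˡ P′-r ⟩
    r ∙ (r ∙ P)         ≈⟨ solve monoid ⟩
    r ∙ (r ∙ ε) ∙ P     ∎

  P-even : ∀ {m} → 2 ∣ m → P ∙ pow G r m ≈ pow G r m ∙ P
  P-even (divides q ≡.refl) = begin
    P ∙ pow G r (q * 2)         ≈⟨ ∙-congˡ (pow-* r q 2) ⟩
    P ∙ pow G (pow G r 2) q     ≈⟨ intertwine P-r² q ⟩
    pow G (pow G r 2) q ∙ P     ≈⟨ ∙-congʳ (pow-* r q 2) ⟨
    pow G r (q * 2) ∙ P         ∎

  P-odd : ∀ {m} → 2 ∣ suc m → P ∙ pow G r m ≈ pow G r m ∙ P′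
  P-odd {m} 2∣1+m = ∙-cancelʳ r _ _ (begin
    (P ∙ pow G r m) ∙ r         ≈⟨ assoc _ _ _ ⟩
    P ∙ (pow G r m ∙ r)         ≈⟨ ∙-congˡ (pow-comm r m) ⟨
    P ∙ pow G r (suc m)         ≈⟨ P-even 2∣1+m ⟩
    (r ∙ pow G r m) ∙ P         ≈⟨ ∙-congʳ (pow-comm r m) ⟩
    (pow G r m ∙ r) ∙ P         ≈⟨ assoc _ _ _ ⟩
    pow G r m ∙ (r ∙ P)         ≈⟨ ∙-congˡ P′-r ⟨
    pow G r m ∙ (P′ ∙ r)        ≈⟨ assoc _ _ _ ⟨
    (pow G r m ∙ P′) ∙ r        ∎)

  RQ≈r⁻¹ : R ∙ Q ≈ pow G r (suc (g + g))
  RQ≈r⁻¹ = inverse-unique (trans (cancel-middle R² Q Q) Q²) rⁿ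

  R-pow : ∀ i → R ∙ pow G r i ≈ pow G r (i * suc (g + g)) ∙ R
  R-pow i = begin
    R ∙ pow G r i                             ≈⟨ intertwine (sym (assoc _ _ _)) i ⟩
    pow G (R ∙ Q) i ∙ R                       ≈⟨ ∙-congʳ (pow-cong RQ≈r⁻¹ i) ⟩
    pow G (pow G r (suc (g + g))) i ∙ R       ≈⟨ ∙-congʳ (pow-* r i _) ⟨
    pow G r (i * suc (g + g)) ∙ R             ∎

  -- The elements of the dihedral subgroup ⟨P, R⟩ of order 8, and the
  -- permutations of this list given by left multiplication by R and by P.
  D : Fin 8 → Carrier
  D d0 = ε
  D d1 = P
  D d2 = R ∙ P
  D d3 = P ∙ (R ∙ P)
  D d4 = R ∙ (P ∙ (R ∙ P))
  D d5 = R
  D d6 = P ∙ R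
  D d7 = R ∙ (P ∙ R)

  R-act P-act : Fin 8 → Fin 8
  R-act d0 = d5
  R-act d1 = d2
  R-act d2 = d1
  R-act d3 = d4
  R-act d4 = d3
  R-act d5 = d0
  R-act d6 = d7
  R-act d7 = d6
  P-act d0 = d1
  P-act d1 = d0
  P-act d2 = d3
  P-act d3 = d2
  P-act d4 = d7
  P-act d5 = d6
  P-act d6 = d5
  P-act d7 = d4

  R-D : ∀ d → R ∙ D d ≈ D (R-act d)
  R-D d0 = identityʳ R
  R-D d1 = refl
  R-D d2 = cancelˡ R² P
  R-D d3 = refl
  R-D d4 = cancelˡ R² _
  R-D d5 = R²
  R-D d6 = refl
  R-D d7 = cancelˡ R² _

  P-D : ∀ d → P ∙ D d ≈ D (P-act d)
  P-D d0 = identityʳ P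
  P-D d1 = P²
  P-D d2 = refl
  P-D d3 = cancelˡ P² _
  P-D d4 = trans (∙-congˡ RPRP≈PRPR) (cancelˡ P² _)
  P-D d5 = refl
  P-D d6 = cancelˡ P² R
  P-D d7 = sym RPRP≈PRPR

  P′-act z-act : Fin 8 → Fin 8
  P′-act d = R-act (P-act (R-act d))
  z-act  d = R-act (P-act (R-act (P-act d)))

  P′-D : ∀ d → P′ ∙ D d ≈ D (P′-act d)
  P′-D d = begin
    (R ∙ (P ∙ R)) ∙ D d         ≈⟨ solve monoid ⟩
    R ∙ (P ∙ (R ∙ D d))         ≈⟨ ∙-congˡ (∙-congˡ (R-D d)) ⟩
    R ∙ (P ∙ D (R-act d))       ≈⟨ ∙-congˡ (P-D (R-act d)) ⟩
    R ∙ D (P-act (R-act d))     ≈⟨ R-D (P-act (R-act d)) ⟩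
    D (P′-act d)                ∎

  z-D : ∀ d → z ∙ D d ≈ D (z-act d)
  z-D d = begin
    z ∙ D d                             ≈⟨ solve monoid ⟩
    R ∙ (P ∙ (R ∙ (P ∙ D d)))           ≈⟨ ∙-congˡ (∙-congˡ (∙-congˡ (P-D d))) ⟩
    R ∙ (P ∙ (R ∙ D (P-act d)))         ≈⟨ ∙-congˡ (∙-congˡ (R-D (P-act d))) ⟩
    R ∙ (P ∙ D (R-act (P-act d)))       ≈⟨ ∙-congˡ (P-D (R-act (P-act d))) ⟩
    R ∙ D (P-act (R-act (P-act d)))     ≈⟨ R-D (P-act (R-act (P-act d))) ⟩
    D (z-act d)                         ∎

  NF : ℕ → Fin 8 → Carrier
  NF i d = pow G r i ∙ D d

  HasNF : Carrier → Set ℓ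
  HasNF x = ∃ λ i → ∃ λ d → x ≈ NF i d

  NF-step : ∀ {x y} i j d d' → x ∙ pow G r i ≈ pow G r j ∙ y → y ∙ D d ≈ D d' → x ∙ NF i d ≈ NF j d'
  NF-step {x} {y} i j d d' x∙rⁱ≈rʲ∙y y∙Dd≈Dd' = begin
    x ∙ (pow G r i ∙ D d)   ≈⟨ assoc _ _ _ ⟨
    (x ∙ pow G r i) ∙ D d   ≈⟨ ∙-congʳ x∙rⁱ≈rʲ∙y ⟩
    (pow G r j ∙ y) ∙ D d   ≈⟨ assoc _ _ _ ⟩
    pow G r j ∙ (y ∙ D d)   ≈⟨ ∙-congˡ y∙Dd≈Dd' ⟩
    NF j d'                 ∎

  r-NF : ∀ i d → r ∙ NF i d ≈ NF (suc i) d
  r-NF i d = sym (assoc _ _ _)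

  R-NF : ∀ i d → R ∙ NF i d ≈ NF (i * suc (g + g)) (R-act d)
  R-NF i d = NF-step i (i * suc (g + g)) d (R-act d) (R-pow i) (R-D d)

  P-NF : ∀ i d → HasNF (P ∙ NF i d)
  P-NF i d with even-or-odd i
  ... | inj₁ 2∣i   = i , P-act d  , NF-step i i d (P-act d) (P-even 2∣i) (P-D d)
  ... | inj₂ 2∣1+i = i , P′-act d , NF-step i i d (P′-act d) (P-odd 2∣1+i) (P′-D d)

  z-NF : ∀ i d → z ∙ NF i d ≈ NF i (z-act d)
  z-NF i d = NF-step i i d (z-act d) (intertwine z-r i) (z-D d)

  Q≈rR : Q ≈ r ∙ R
  Q≈rR = trans (sym (identityʳ Q)) (trans (∙-congˡ (sym R²)) (sym (assoc _ _ _)))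

  Q-NF : ∀ i d → Q ∙ NF i d ≈ NF (suc (i * suc (g + g))) (R-act d)
  Q-NF i d = begin
    Q ∙ NF i d                            ≈⟨ ∙-congʳ Q≈rR ⟩
    (r ∙ R) ∙ NF i d                      ≈⟨ assoc _ _ _ ⟩
    r ∙ (R ∙ NF i d)                      ≈⟨ ∙-congˡ (R-NF i d) ⟩
    r ∙ NF (i * suc (g + g)) (R-act d)    ≈⟨ r-NF (i * suc (g + g)) (R-act d) ⟩
    NF (suc (i * suc (g + g))) (R-act d)  ∎

  gen-NF : ∀ X i d → HasNF (gen G P Q R X ∙ NF i d)
  gen-NF gP i d = P-NF i d
  gen-NF gQ i d = suc (i * suc (g + g)) , R-act d , Q-NF i d
  gen-NF gR i d = i * suc (g + g) , R-act d , R-NF i d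

  word-NF : ∀ w → HasNF (evalWord G P Q R w)
  word-NF []      = 0 , d0 , sym (identityʳ ε)
  word-NF (X ∷ w) with word-NF w
  ... | i , d , w≈NF with gen-NF X i d
  ...   | j , d' , X∙NF≈NF = j , d' , trans (∙-congˡ w≈NF) X∙NF≈NF

  f² : f ∙ f ≈ ε
  f² = trans (sym (pow-+ r (suc g) (suc g)))
             (≡.subst (λ m → pow G r m ≈ ε) (≡.sym ([g+1]+[g+1]≡n g)) rⁿ)

  z-f : z ∙ f ≈ f ∙ z
  z-f = intertwine z-r (suc g)

  R-f : R ∙ f ≈ f ∙ R
  R-f = begin
    R ∙ f                                ≈⟨ R-pow (suc g) ⟩
    pow G r (suc g * suc (g + g)) ∙ R    ≡⟨ ≡.cong (λ m → pow G r m ∙ R) ([g+1][2g+1]≡[g+1]+gn g) ⟩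
    pow G r (suc g + g * n) ∙ R          ≈⟨ ∙-congʳ (pow-+ r (suc g) (g * n)) ⟩
    (f ∙ pow G r (g * n)) ∙ R            ≈⟨ ∙-congʳ (∙-congˡ (pow-multiple rⁿ g)) ⟩
    (f ∙ ε) ∙ R                          ≈⟨ ∙-congʳ (identityʳ f) ⟩
    f ∙ R                                ∎

  Q-f : Q ∙ f ≈ f ∙ Q
  Q-f = begin
    Q ∙ f          ≈⟨ ∙-congʳ Q≈rR ⟩
    (r ∙ R) ∙ f    ≈⟨ commute-∙ (sym (pow-comm r (suc g))) (sym R-f) ⟨
    f ∙ (r ∙ R)    ≈⟨ ∙-congˡ Q≈rR ⟨
    f ∙ Q          ∎

  P-f-odd : ¬ 2 ∣ g → P ∙ f ≈ f ∙ P
  P-f-odd g-odd with even-or-odd g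
  ... | inj₁ 2∣g   = ⊥-elim (g-odd 2∣g)
  ... | inj₂ 2∣1+g = P-even 2∣1+g

  P-f-even : 2 ∣ g → P ∙ f ≈ f ∙ P′
  P-f-even 2∣g = P-odd (∣m∣n⇒∣m+n ∣-refl 2∣g)

  f∙r : ∀ x → f ∙ (r ∙ x) ≈ pow G r (suc (suc g)) ∙ x
  f∙r x = trans (sym (assoc _ _ _)) (∙-congʳ (sym (pow-comm r (suc g))))

  z≈NF : z ≈ NF 0 d4
  z≈NF = trans z≈RPRP (sym (identityˡ _))

  e≈rRP : e ≈ r ∙ (R ∙ P)
  e≈rRP = begin
    P ∙ Q              ≈⟨ PQ-comm ⟩
    Q ∙ P              ≈⟨ ∙-congʳ Q≈rR ⟩
    (r ∙ R) ∙ P        ≈⟨ assoc _ _ _ ⟩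
    r ∙ (R ∙ P)        ∎

  e≈NF : e ≈ NF 1 d2
  e≈NF = trans e≈rRP (∙-congʳ (sym (identityʳ r)))

  f≈NF : f ≈ NF (suc g) d0
  f≈NF = sym (identityʳ f)

  ze≈NF : z ∙ e ≈ NF 1 d6
  ze≈NF = trans (∙-congˡ e≈NF) (z-NF 1 d2)

  zf≈NF : z ∙ f ≈ NF (suc g) d4
  zf≈NF = trans (∙-congˡ f≈NF) (z-NF (suc g) d0)

  ef≈NF-odd : P ∙ f ≈ f ∙ P → e ∙ f ≈ NF (suc (suc g)) d2
  ef≈NF-odd P-f = begin
    (P ∙ Q) ∙ f        ≈⟨ commute-∙ (sym P-f) (sym Q-f) ⟨
    f ∙ (P ∙ Q)        ≈⟨ ∙-congˡ e≈rRP ⟩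
    f ∙ (r ∙ (R ∙ P))  ≈⟨ f∙r _ ⟩
    NF (suc (suc g)) d2 ∎

  ef≈fP′Q : P ∙ f ≈ f ∙ P′ → e ∙ f ≈ f ∙ (P′ ∙ Q)
  ef≈fP′Q P-f = begin
    (P ∙ Q) ∙ f        ≈⟨ assoc _ _ _ ⟩
    P ∙ (Q ∙ f)        ≈⟨ ∙-congˡ Q-f ⟩
    P ∙ (f ∙ Q)        ≈⟨ assoc _ _ _ ⟨
    (P ∙ f) ∙ Q        ≈⟨ ∙-congʳ P-f ⟩
    (f ∙ P′) ∙ Q       ≈⟨ assoc _ _ _ ⟩
    f ∙ (P′ ∙ Q)       ∎

  ef≈NF-even : P ∙ f ≈ f ∙ P′ → e ∙ f ≈ NF (suc (suc g)) d6
  ef≈NF-even P-f = begin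
    e ∙ f                 ≈⟨ ef≈fP′Q P-f ⟩
    f ∙ (P′ ∙ Q)          ≈⟨ ∙-congˡ (∙-congˡ Q≈rR) ⟩
    f ∙ (P′ ∙ (r ∙ R))    ≈⟨ ∙-congˡ (assoc _ _ _) ⟨
    f ∙ ((P′ ∙ r) ∙ R)    ≈⟨ ∙-congˡ (∙-congʳ P′-r) ⟩
    f ∙ ((r ∙ P) ∙ R)     ≈⟨ ∙-congˡ (assoc _ _ _) ⟩
    f ∙ (r ∙ (P ∙ R))     ≈⟨ f∙r _ ⟩
    NF (suc (suc g)) d6   ∎

  zef≈NF-even : P ∙ f ≈ f ∙ P′ → z ∙ (e ∙ f) ≈ NF (suc (suc g)) d2
  zef≈NF-even P-f = trans (∙-congˡ (ef≈NF-even P-f)) (z-NF (suc (suc g)) d6)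

  efef≈z : P ∙ f ≈ f ∙ P′ → (e ∙ f) ∙ (e ∙ f) ≈ z
  efef≈z P-f = begin
    (e ∙ f) ∙ (e ∙ f)                 ≈⟨ ∙-congʳ (ef≈fP′Q P-f) ⟩
    (f ∙ (P′ ∙ Q)) ∙ ((P ∙ Q) ∙ f)    ≈⟨ solve monoid ⟩
    f ∙ ((P′ ∙ Q) ∙ (P ∙ Q)) ∙ f      ≈⟨ ∙-congʳ (∙-congˡ (∙-congˡ PQ-comm)) ⟩
    f ∙ ((P′ ∙ Q) ∙ (Q ∙ P)) ∙ f      ≈⟨ ∙-congʳ (∙-congˡ (cancel-middle Q² P′ P)) ⟩
    f ∙ (P′ ∙ P) ∙ f                  ≈⟨ ∙-congʳ (∙-congˡ P′P≈z) ⟩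
    f ∙ z ∙ f                         ≈⟨ ∙-congʳ z-f ⟨
    z ∙ f ∙ f                         ≈⟨ cancelʳ f² z ⟩
    z                                 ∎
    where
    P′P≈z : R ∙ (P ∙ R) ∙ P ≈ (R ∙ P) ∙ ((R ∙ P) ∙ ε)
    P′P≈z = solve monoid

  -- When G is generated by P, Q, R and has exactly 8n elements, the 8n reduced
  -- normal forms (i < n) are pairwise distinct.
  module Counting (generates : Generates G P Q R) (order : HasOrder G (8 * n)) where
    open MirrorWalks G g P Q R

    reduced-NF : ∀ x → ∃ λ i → ∃ λ d → i < n × x ≈ NF i d
    reduced-NF x with generates x
    ... | w , w≈x with word-NF w
    ...   | i , d , w≈NF =
      i % n , d , m%n<n i n , trans (sym w≈x) (trans w≈NF (∙-congʳ (pow-mod rⁿ i)))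

    indexed-NF : Fin (8 * n) → Carrier
    indexed-NF a = NF (toℕ (proj₂ (remQuot {8} n a))) (proj₁ (remQuot {8} n a))

    index-of : ∀ {i} → i < n → Fin 8 → Fin (8 * n)
    index-of i<n d = combine d (fromℕ< i<n)

    indexed-NF-index-of : ∀ {i} (i<n : i < n) d → indexed-NF (index-of i<n d) ≡ NF i d
    indexed-NF-index-of {i} i<n d =
      ≡.trans (≡.cong (λ (d , j) → NF (toℕ j) d) (remQuot-combine {8} {n} d (fromℕ< i<n)))
              (≡.cong (λ j → NF j d) (toℕ-fromℕ< i<n))

    indexed-NF-onto : ∀ x → ∃ λ a → indexed-NF a ≈ x
    indexed-NF-onto x with reduced-NF x
    ... | i , d , i<n , x≈NF = index-of i<n d , trans (reflexive (indexed-NF-index-of i<n d)) (sym x≈NF)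

    NF-injective : ∀ {i j d d'} → i < n → j < n → NF i d ≈ NF j d' → (i , d) ≡ (j , d')
    NF-injective {i} {j} {d} {d'} i<n j<n NF≈NF
      with combine-injective d (fromℕ< i<n) d' (fromℕ< j<n)
             (surjection-injective order indexed-NF indexed-NF-onto _ _
               (trans (reflexive (indexed-NF-index-of i<n d))
                 (trans NF≈NF (reflexive (≡.sym (indexed-NF-index-of j<n d'))))))
    ... | d≡d' , i≡j = ≡.cong₂ _,_ (fromℕ<-injective i j i<n j<n i≡j) d≡d'

    nf : Gen → ℕ × Fin 8
    nf gP = 0 , d1
    nf gQ = 1 , d5
    nf gR = 0 , d5

    gen≈NF : ∀ X → gen G P Q R X ≈ NF (proj₁ (nf X)) (proj₂ (nf X))
    gen≈NF gP = sym (identityˡ P)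
    gen≈NF gQ = trans Q≈rR (∙-congʳ (sym (identityʳ r)))
    gen≈NF gR = sym (identityˡ R)

    leaves : ∀ X {x} i d → i < n → x ≈ NF i d → (i , d) ≢ (0 , d0) → (i , d) ≢ nf X → LeavesSide X x
    leaves X i d i<n x≈NF ≢ε ≢X =
        (λ x≈ε → ≢ε (NF-injective i<n (s≤s z≤n) (trans (sym x≈NF) (trans x≈ε (sym (identityʳ ε))))))
      , (λ x≈X → ≢X (NF-injective i<n (nf-reduced X) (trans (sym x≈NF) (trans x≈X (gen≈NF X)))))
      where
      nf-reduced : ∀ X → proj₁ (nf X) < n
      nf-reduced gP = s≤s z≤n
      nf-reduced gQ = s≤s (s≤s z≤n)
      nf-reduced gR = s≤s z≤n

    1<n : 1 < n
    1<n = s≤s (s≤s z≤n)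

    g+1<n : suc g < n
    g+1<n = s≤s (s≤s (ℕP.m≤m+n g g))

    g+2<n : 0 < g → suc (suc g) < n
    g+2<n 0<g = s≤s (s≤s (ℕP.≤-trans (ℕP.≤-reflexive (ℕP.+-comm 1 g)) (ℕP.+-monoʳ-≤ g 0<g)))

    P-mirror : ∀ k → MirrorPattern G g P Q R k gP ((𝟎 ∷ 𝟏 ∷ []) ^ʷ 2)
    P-mirror = mirror-of-commuting-turns gP z² e² z-e
      (leaves gP 0 d4 (s≤s z≤n) z≈NF (λ ()) (λ ()))
      (leaves gP 1 d6 1<n ze≈NF (λ ()) (λ ()))
      (leaves gP 1 d2 1<n e≈NF (λ ()) (λ ()))

    R-mirror : ∀ k → MirrorPattern G g P Q R k gR ((𝟎 ∷ 𝟐 ∷ []) ^ʷ 2)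
    R-mirror = mirror-of-commuting-turns gR z² f² z-f
      (leaves gR 0 d4 (s≤s z≤n) z≈NF (λ ()) (λ ()))
      (leaves gR (suc g) d4 g+1<n zf≈NF (λ ()) (λ ()))
      (leaves gR (suc g) d0 g+1<n f≈NF (λ ()) (λ ()))

    Q-mirror-odd : 0 < g → P ∙ f ≈ f ∙ P → ∀ k → MirrorPattern G g P Q R k gQ ((𝟏 ∷ 𝟐 ∷ []) ^ʷ 2)
    Q-mirror-odd 0<g P-f = mirror-of-commuting-turns gQ e² f² e-f
      (leaves gQ 1 d2 1<n e≈NF (λ ()) (λ ()))
      (leaves gQ (suc (suc g)) d2 (g+2<n 0<g) (ef≈NF-odd P-f) (λ ()) (λ ()))
      (leaves gQ (suc g) d0 g+1<n f≈NF (λ ()) (λ ()))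
      where
      e-f : e ∙ f ≈ f ∙ e
      e-f = sym (commute-∙ (sym P-f) (sym Q-f))

    -- The mirror through a side of type Q when P f = f P′ (g even): the
    -- translation e f along the mirror squares to the central involution z.
    Q-mirror-even : 0 < g → P ∙ f ≈ f ∙ P′ → ∀ k → MirrorPattern G g P Q R k gQ ((𝟏 ∷ 𝟐 ∷ []) ^ʷ 4)
    Q-mirror-even 0<g P-f = mirror-of-order-four-translation gQ e² f² (efef≈z P-f) z²
      (leaves gQ 1 d2 1<n e≈NF (λ ()) (λ ()))
      (leaves gQ (suc (suc g)) d6 (g+2<n 0<g) (ef≈NF-even P-f) (λ ()) (λ ()))
      (leaves gQ (suc g) d4 g+1<n zf≈NF (λ ()) (λ ()))
      (leaves gQ 0 d4 (s≤s z≤n) z≈NF (λ ()) (λ ()))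
      (leaves gQ 1 d6 1<n ze≈NF (λ ()) (λ ()))
      (leaves gQ (suc (suc g)) d2 (g+2<n 0<g) (zef≈NF-even P-f) (λ ()) (λ ()))
      (leaves gQ (suc g) d0 g+1<n f≈NF (λ ()) (λ ()))

-- Proposition 6.1.
proposition6p1 : (g : ℕ) → 1 < g
    → (G : Group 0ℓ 0ℓ) → (P Q R : Group.Carrier G)
    → AMRelations G g P Q R → Generates G P Q R → HasOrder G (16 * (g + 1))
    → ∀ (t k : Group.Carrier G)
    → (FixesSide G P Q R t k gP → MirrorPattern G g P Q R k gP ((𝟎 ∷ 𝟏 ∷ []) ^ʷ 2))
      × (FixesSide G P Q R t k gR → MirrorPattern G g P Q R k gR ((𝟎 ∷ 𝟐 ∷ []) ^ʷ 2))
      × (¬ (2 ∣ g) → FixesSide G P Q R t k gQ → MirrorPattern G g P Q R k gQ ((𝟏 ∷ 𝟐 ∷ []) ^ʷ 2))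
      × (2 ∣ g → FixesSide G P Q R t k gQ → MirrorPattern G g P Q R k gQ ((𝟏 ∷ 𝟐 ∷ []) ^ʷ 4))
proposition6p1 g 1<g G P Q R rel generates order t k =
    (λ _ → P-mirror k)
  , (λ _ → R-mirror k)
  , (λ g-odd  _ → Q-mirror-odd  0<g (P-f-odd g-odd)   k)
  , (λ g-even _ → Q-mirror-even 0<g (P-f-even g-even) k)
  where
  open AccolaMaclachlan G g P Q R rel
  open Counting generates (≡.subst (HasOrder G) (16[g+1]≡8n g) order)
  0<g : 0 < g
  0<g = ℕP.<-trans (s≤s z≤n) 1<g
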